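{- There are infinitely many pairwise non-isomorphic connected super vertex-oblique graphs $G$ with unique vertex-type sequence, i.e. such that every graph with the same vertex-type sequence as $G$ is isomorphic to $G$.
   Context: All graphs are finite and simple. For a vertex $v$ of degree $r$ in a graph $G$ whose neighbours have degrees $x_1 \geq \cdots \geq x_r$ (degrees taken in $G$), the vertex type of $v$ is $(x_1,\ldots,x_r)$; vertex types in the complement $\overline{G}$ are computed in $\overline{G}$. A graph is vertex-oblique if distinct vertices have distinct vertex types. A graph $G$ is super vertex-oblique if it is vertex-oblique and moreover no vertex type of $G$ equals any vertex type of $\overline{G}$. The vertex-type sequence of a graph is the multiset of vertex types of its vertices. -}

module Defs where

open import Data.Nat using (ℕ; zero; suc)
open import Data.Nat.Properties using (≤-decTotalOrder)
open import Data.Bool using (Bool; true; false; not; _∧_; T)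
open import Data.Fin using (Fin; _≟_)
open import Data.List using (List; []; _∷_; map; length; reverse; allFin)
open import Data.List.Relation.Binary.Permutation.Propositional using (_↭_)
open import Data.List.Sort.MergeSort ≤-decTotalOrder using (mergeSort)
open import Data.List.Sort.Base using (SortingAlgorithm)
open import Data.Product using (Σ; _×_; _,_)
open import Function.Bundles using (Bijection; _⤖_)
open import Relation.Nullary using (¬_; does)
open import Relation.Binary.PropositionalEquality using (_≡_; _≢_)

record Graph (n : ℕ) : Set where
  field
    adj   : Fin n → Fin n → Bool
    sym   : ∀ u v → adj u v ≡ adj v u
    irrefl : ∀ v → adj v v ≡ false
open Graph public

filterB : {A : Set} → (A → Bool) → List A → List A
filterB p [] = []
filterB p (x ∷ xs) with p x
... | true  = x ∷ filterB p xs
... | false = filterB p xs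

neighbours : {n : ℕ} → Graph n → Fin n → List (Fin n)
neighbours {n} G v = filterB (adj G v) (allFin n)

degree : {n : ℕ} → Graph n → Fin n → ℕ
degree G v = length (neighbours G v)

sortDesc : List ℕ → List ℕ
sortDesc xs = reverse (SortingAlgorithm.sort mergeSort xs)

vertexType : {n : ℕ} → Graph n → Fin n → List ℕ
vertexType G v = sortDesc (map (degree G) (neighbours G v))

complement : {n : ℕ} → Graph n → Graph n
complement {n} G = record
  { adj = λ u v → not (adj G u v) ∧ not (does (u ≟ v))
  ; sym = symC
  ; irrefl = irrC
  }
  where
  open import Relation.Binary.PropositionalEquality using (refl; cong₂; cong)
  open import Relation.Nullary using (yes; no)
  symC : ∀ u v → (not (adj G u v) ∧ not (does (u ≟ v))) ≡ (not (adj G v u) ∧ not (does (v ≟ u)))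
  symC u v with u ≟ v | v ≟ u
  ... | yes _ | yes _ = cong₂ _∧_ (cong not (Graph.sym G u v)) refl
  ... | no _  | no _  = cong₂ _∧_ (cong not (Graph.sym G u v)) refl
  ... | yes p | no q  = Data.Empty.⊥-elim (q (Relation.Binary.PropositionalEquality.sym p))
    where import Data.Empty
  ... | no q  | yes p = Data.Empty.⊥-elim (q (Relation.Binary.PropositionalEquality.sym p))
    where import Data.Empty
  irrC : ∀ v → (not (adj G v v) ∧ not (does (v ≟ v))) ≡ false
  irrC v with v ≟ v
  ... | yes _ = Data.Bool.Properties.∧-zeroʳ (not (adj G v v))
    where import Data.Bool.Properties
  ... | no q  = Data.Empty.⊥-elim (q refl)
    where import Data.Empty

data Walk {n : ℕ} (G : Graph n) : Fin n → Fin n → Set where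
  here : ∀ {v} → Walk G v v
  step : ∀ {u w v} → T (adj G u w) → Walk G w v → Walk G u v

-- connected (the empty graph on 0 vertices is excluded: graphs have ≥ 1 vertex)
Connected : {n : ℕ} → Graph n → Set
Connected {n} G = Σ (Fin n) (λ _ → ⊤') × (∀ u v → Walk G u v)
  where open import Data.Unit using () renaming (⊤ to ⊤')

VertexOblique : {n : ℕ} → Graph n → Set
VertexOblique G = ∀ u v → vertexType G u ≡ vertexType G v → u ≡ v

SuperVertexOblique : {n : ℕ} → Graph n → Set
SuperVertexOblique G =
  VertexOblique G × (∀ u v → vertexType G u ≢ vertexType (complement G) v)

vertexTypeList : {n : ℕ} → Graph n → List (List ℕ)
vertexTypeList {n} G = map (vertexType G) (allFin n)

SameVertexTypeSequence : {m n : ℕ} → Graph m → Graph n → Set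
SameVertexTypeSequence G H = vertexTypeList G ↭ vertexTypeList H

Isomorphic : {m n : ℕ} → Graph m → Graph n → Set
Isomorphic {m} {n} G H =
  Σ (Fin m ⤖ Fin n) λ f →
    ∀ u v → adj G u v ≡ adj H (Bijection.to f u) (Bijection.to f v)

UniqueVertexTypeSequence : {n : ℕ} → Graph n → Set
UniqueVertexTypeSequence {n} G =
  ∀ (m : ℕ) (H : Graph m) → SameVertexTypeSequence H G → Isomorphic H G

module Submission where

-- Start from a six-vertex graph and iterate the cone construction, which adds an apex joined to
-- all vertices and a pendant vertex joined only to the apex.  Coning preserves vertex-obliqueness,
-- the absence of isolated vertices, and the property that for distinct u, v one of them, say u,
-- is adjacent to the other iff the degree of v occurs in the vertex type of u.  Such a graph is
-- determined by its vertex-type sequence: matching vertices of equal type is a bijection that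
-- preserves adjacency by the last property and reflects it by counting neighbours.  A cone is
-- connected, and it is super vertex-oblique because the apex degree exceeds every degree in the
-- complement while every other vertex has the apex as a neighbour.  The i-th graph has 2i + 8
-- vertices, so no two are isomorphic.

open import Data.Bool using (Bool; true; false; T; _∨_)
open import Data.Bool.Properties using (T?; ∨-comm) renaming (_≟_ to _≟ᵇ_)
open import Data.Empty using (⊥-elim)
open import Data.Fin using (Fin; zero; suc; toℕ) renaming (_≟_ to _≟ᶠ_)
open import Data.Fin.Properties using (injective⇒≤; all?)
open import Data.List using (List; []; _∷_; map; length; reverse; allFin; tabulate; filter)
open import Data.List.Properties
  using (≡-dec; filter-notAll; filter-all; filter-none; length-tabulate; map-tabulate; length-map; map-∘; map-id; map-cong)
open import Data.List.Membership.Propositional using (_∈_; _∉_)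
open import Data.List.Membership.Propositional.Properties using (∈-filter⁺; ∈-filter⁻; ∈-map⁺; ∈-map⁻; ∈-allFin)
open import Data.List.Relation.Binary.Permutation.Propositional using (_↭_; ↭-sym; ↭-trans; ↭⇒↭ₛ)
open import Data.List.Relation.Binary.Permutation.Propositional.Properties
  using (∈-resp-↭; ↭-length; ↭-reverse; drop-∷) renaming (map⁺ to ↭-map⁺)
import Data.List.Relation.Binary.Permutation.Setoid.Properties as Setoid↭
open import Data.List.Relation.Binary.Pointwise using (Pointwise-≡⇒≡)
open import Data.List.Relation.Binary.Subset.Propositional using (_⊆_)
import Data.List.Relation.Unary.All as All
open import Data.List.Relation.Unary.Any as Any using (here; there)
open import Data.List.Relation.Unary.Unique.Propositional using (Unique; []; _∷_)
open import Data.List.Relation.Unary.Unique.Propositional.Properties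
  using (allFin⁺) renaming (map⁺ to unique-map⁺; filter⁺ to unique-filter⁺)
open import Data.List.Relation.Unary.Sorted.TotalOrder.Properties using (↗↭↗⇒≋)
open import Data.List.Sort.Base using (SortingAlgorithm)
open import Data.Nat using (ℕ; zero; suc; _≤_; _<_; z≤n; pred; 2+; ⌊_/2⌋)
import Data.Nat as ℕ
open import Data.Nat.Properties using (≤-decTotalOrder; ≤-totalOrder; ≤-pred; ≤-<-trans; <-irrefl; ≤-antisym; suc-injective)
open import Data.List.Sort.MergeSort ≤-decTotalOrder using (mergeSort)
open import Data.Product using (Σ; Σ-syntax; ∃; _×_; _,_; proj₁; proj₂)
open import Data.Sum using (_⊎_; inj₁; inj₂)
open import Data.Unit using (tt)
open import Function using (_∘_; id; case_of_)
open import Function.Bundles using (Bijection; _⤖_; mk⤖)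
open import Function.Definitions using (Injective)
open import Function.Properties.Bijection using () renaming (sym-≡ to ⤖-sym)
open import Level using (Level)
open import Relation.Binary.Definitions using (DecidableEquality)
open import Relation.Binary.PropositionalEquality
  using (_≡_; _≢_; _≗_; setoid; refl; sym; trans; cong; cong₂; subst; subst₂; module ≡-Reasoning)
open import Relation.Nullary using (¬_; ¬?; Dec; yes; no)
open import Relation.Nullary.Decidable using (toWitness; _→-dec_; _⊎-dec_)
open import Relation.Unary using (Pred; Decidable)

open import Defs hiding (sym)

filterB≗filter : {A : Set} (p : A → Bool) → filterB p ≗ filter (T? ∘ p)
filterB≗filter p [] = refl
filterB≗filter p (x ∷ xs) with p x
... | true  = cong (x ∷_) (filterB≗filter p xs)
... | false = filterB≗filter p xs

filter-map : {A B : Set} {ℓ : Level} {P : Pred B ℓ} (P? : Decidable P) (f : A → B) →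
             filter P? ∘ map f ≗ map f ∘ filter (P? ∘ f)
filter-map P? f [] = refl
filter-map P? f (x ∷ xs) with P? (f x)
... | yes _ = cong (f x ∷_) (filter-map P? f xs)
... | no _  = filter-map P? f xs

module _ {A : Set} (_≟_ : DecidableEquality A) where

  private
    without : A → List A → List A
    without y = filter (λ z → ¬? (z ≟ y))

    ⊆-without : ∀ {xs ys y} → xs ⊆ ys → y ∉ xs → xs ⊆ without y ys
    ⊆-without xs⊆ys y∉xs z∈xs = ∈-filter⁺ _ (xs⊆ys z∈xs) λ { refl → y∉xs z∈xs }

    length-without : ∀ {ys y} → y ∈ ys → length (without y ys) < length ys
    length-without {ys} y∈ys = filter-notAll _ ys (Any.map (λ { refl ¬≢ → ¬≢ refl }) y∈ys)

  Unique-⊆⇒length≤ : ∀ {xs ys} → Unique xs → xs ⊆ ys → length xs ≤ length ys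
  Unique-⊆⇒length≤ []             _     = z≤n
  Unique-⊆⇒length≤ (x∉xs ∷ xs!) xs⊆ys =
    ≤-<-trans (Unique-⊆⇒length≤ xs! (⊆-without (xs⊆ys ∘ there) (λ x∈xs → All.lookup x∉xs x∈xs refl)))
              (length-without (xs⊆ys (here refl)))

  Unique-⊆-∌⇒length< : ∀ {xs ys y} → Unique xs → xs ⊆ ys → y ∈ ys → y ∉ xs → length xs < length ys
  Unique-⊆-∌⇒length< xs! xs⊆ys y∈ys y∉xs =
    ≤-<-trans (Unique-⊆⇒length≤ xs! (⊆-without xs⊆ys y∉xs)) (length-without y∈ys)

Unique-map⇒injective : {A B : Set} (t : A → B) {xs : List A} → Unique (map t xs) →
                       ∀ {x y} → x ∈ xs → y ∈ xs → t x ≡ t y → x ≡ y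
Unique-map⇒injective t (_ ∷ _)     (here refl) (here refl) _   = refl
Unique-map⇒injective t (tx∉ ∷ _)   (here refl) (there y∈)  txy = ⊥-elim (All.lookup tx∉ (∈-map⁺ t y∈) txy)
Unique-map⇒injective t (ty∉ ∷ _)   (there x∈)  (here refl) txy = ⊥-elim (All.lookup ty∉ (∈-map⁺ t x∈) (sym txy))
Unique-map⇒injective t (_ ∷ txs!)  (there x∈)  (there y∈)  txy = Unique-map⇒injective t txs! x∈ y∈ txy

module _ {B : Set} {m n : ℕ} {t : Fin m → B} {s : Fin n → B} (s-injective : Injective _≡_ _≡_ s)
         (t↭s : map t (allFin m) ↭ map s (allFin n)) where

  private
    match : ∀ x → ∃ λ v → t x ≡ s v
    match x with ∈-map⁻ s (∈-resp-↭ t↭s (∈-map⁺ t (∈-allFin x)))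
    ... | v , _ , tx≡sv = v , tx≡sv

    comatch : ∀ v → ∃ λ x → s v ≡ t x
    comatch v with ∈-map⁻ t (∈-resp-↭ (↭-sym t↭s) (∈-map⁺ s (∈-allFin v)))
    ... | x , _ , sv≡tx = x , sv≡tx

    t-injective : Injective _≡_ _≡_ t
    t-injective = Unique-map⇒injective t
      (Setoid↭.Unique-resp-↭ (setoid B) (↭⇒↭ₛ (↭-sym t↭s)) (unique-map⁺ s-injective (allFin⁺ n)))
      (∈-allFin _) (∈-allFin _)

    f : Fin m → Fin n
    f = proj₁ ∘ match

    f-injective : Injective _≡_ _≡_ f
    f-injective {x} {y} fx≡fy =
      t-injective (trans (proj₂ (match x)) (trans (cong s fx≡fy) (sym (proj₂ (match y)))))

  map-allFin-↭⇒⤖ : Σ[ φ ∈ Fin m ⤖ Fin n ] (∀ x → t x ≡ s (Bijection.to φ x))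
  map-allFin-↭⇒⤖ = mk⤖ (f-injective , surjective) , proj₂ ∘ match
    where
    surjective : ∀ v → ∃ λ x → ∀ {z} → z ≡ x → f z ≡ v
    surjective v with comatch v
    ... | x , sv≡tx = x , λ { refl → s-injective (trans (sym (proj₂ (match x))) (sym sv≡tx)) }

private
  module Sort = SortingAlgorithm mergeSort

sortDesc-↭ : ∀ xs → sortDesc xs ↭ xs
sortDesc-↭ xs = ↭-trans (↭-reverse (Sort.sort xs)) (Sort.sort-↭ xs)

↭⇒sortDesc-≡ : ∀ {xs ys} → xs ↭ ys → sortDesc xs ≡ sortDesc ys
↭⇒sortDesc-≡ {xs} {ys} xs↭ys = cong reverse (Pointwise-≡⇒≡
  (↗↭↗⇒≋ ≤-totalOrder (Sort.sort-↗ xs) (Sort.sort-↗ ys)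
    (↭⇒↭ₛ (↭-trans (Sort.sort-↭ xs) (↭-trans xs↭ys (↭-sym (Sort.sort-↭ ys)))))))

sortDesc-≡⇒↭ : ∀ {xs ys} → sortDesc xs ≡ sortDesc ys → xs ↭ ys
sortDesc-≡⇒↭ {xs} {ys} eq =
  ↭-trans (↭-sym (sortDesc-↭ xs)) (subst (_↭ ys) (sym eq) (sortDesc-↭ ys))

neighbourDegrees : {n : ℕ} → Graph n → Fin n → List ℕ
neighbourDegrees G v = map (degree G) (neighbours G v)

module _ {n : ℕ} (G : Graph n) where

  ¬adjacent-self : ∀ v → ¬ T (adj G v v)
  ¬adjacent-self v = subst T (irrefl G v)

  adjacent-sym : ∀ {v w} → T (adj G v w) → T (adj G w v)
  adjacent-sym {v} {w} = subst T (Graph.sym G v w)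

  adjacent⇒≢ : ∀ {v w} → T (adj G v w) → v ≢ w
  adjacent⇒≢ {v} vw refl = ¬adjacent-self v vw

  neighbours≡filter : ∀ v → neighbours G v ≡ filter (T? ∘ adj G v) (allFin n)
  neighbours≡filter v = filterB≗filter (adj G v) (allFin n)

  adjacent⇒∈neighbours : ∀ {v w} → T (adj G v w) → w ∈ neighbours G v
  adjacent⇒∈neighbours {v} {w} vw =
    subst (w ∈_) (sym (neighbours≡filter v)) (∈-filter⁺ (T? ∘ adj G v) (∈-allFin {n} w) vw)

  ∈neighbours⇒adjacent : ∀ {v w} → w ∈ neighbours G v → T (adj G v w)
  ∈neighbours⇒adjacent {v} w∈ =
    proj₂ (∈-filter⁻ (T? ∘ adj G v) {xs = allFin n} (subst (_ ∈_) (neighbours≡filter v) w∈))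

  neighbours-unique : ∀ v → Unique (neighbours G v)
  neighbours-unique v = subst Unique (sym (neighbours≡filter v)) (unique-filter⁺ (T? ∘ adj G v) (allFin⁺ n))

  private
    pigeonhole : ∀ {xs v} → Unique xs → v ∉ xs → length xs < n
    pigeonhole {xs} {v} xs! v∉xs = subst (length xs <_) (length-tabulate id)
      (Unique-⊆-∌⇒length< _≟ᶠ_ xs! (λ {w} _ → ∈-allFin {n} w) (∈-allFin {n} v) v∉xs)

  degree<order : ∀ v → degree G v < n
  degree<order v = pigeonhole (neighbours-unique v) (¬adjacent-self v ∘ ∈neighbours⇒adjacent)

  non-neighbour⇒degree< : ∀ {v w} → v ≢ w → ¬ T (adj G v w) → suc (degree G v) < n
  non-neighbour⇒degree< {v} {w} v≢w ¬vw = pigeonhole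
    (All.tabulate (λ {u} u∈ → λ { refl → ¬vw (∈neighbours⇒adjacent u∈) }) ∷ neighbours-unique v)
    λ { (here v≡w) → v≢w v≡w ; (there v∈) → ¬adjacent-self v (∈neighbours⇒adjacent v∈) }

  length-vertexType : ∀ v → length (vertexType G v) ≡ degree G v
  length-vertexType v = trans (↭-length (sortDesc-↭ (neighbourDegrees G v))) (length-map (degree G) (neighbours G v))

  ∈-vertexType⁺ : ∀ {v w} → T (adj G v w) → degree G w ∈ vertexType G v
  ∈-vertexType⁺ {v} vw =
    ∈-resp-↭ (↭-sym (sortDesc-↭ (neighbourDegrees G v))) (∈-map⁺ (degree G) (adjacent⇒∈neighbours vw))

  ∈-vertexType⁻ : ∀ {v d} → d ∈ vertexType G v → ∃ λ w → T (adj G v w) × d ≡ degree G w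
  ∈-vertexType⁻ {v} d∈ with ∈-map⁻ (degree G) (∈-resp-↭ (sortDesc-↭ (neighbourDegrees G v)) d∈)
  ... | w , w∈ , d≡ = w , ∈neighbours⇒adjacent w∈ , d≡

vertexType≡⇒degree≡ : ∀ {m n} (G : Graph m) (H : Graph n) {v x} →
                      vertexType G v ≡ vertexType H x → degree G v ≡ degree H x
vertexType≡⇒degree≡ G H {v} {x} eq =
  trans (sym (length-vertexType G v)) (trans (cong length eq) (length-vertexType H x))

Isomorphic⇒order≡ : ∀ {m n} (G : Graph m) (H : Graph n) → Isomorphic G H → m ≡ n
Isomorphic⇒order≡ _ _ (φ , _) =
  ≤-antisym (injective⇒≤ (Bijection.injective φ)) (injective⇒≤ (Bijection.injective (⤖-sym φ)))

T-⇔⇒≡ : ∀ {a b} → (T a → T b) → (T b → T a) → a ≡ b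
T-⇔⇒≡ {false} {false} _ _ = refl
T-⇔⇒≡ {false} {true}  _ b⇒a = ⊥-elim (b⇒a _)
T-⇔⇒≡ {true}  {false} a⇒b _ = ⊥-elim (a⇒b _)
T-⇔⇒≡ {true}  {true}  _ _ = refl

-- When this holds, u ~ v iff the degree of v occurs in the vertex type of u.
AdjacencyReadable : {n : ℕ} → Graph n → Fin n → Fin n → Set
AdjacencyReadable G u v = ∀ w → T (adj G u w) → degree G w ≡ degree G v → T (adj G u v)

AdjacencyDetermined : {n : ℕ} → Graph n → Set
AdjacencyDetermined G = ∀ u v → u ≢ v → AdjacencyReadable G u v ⊎ AdjacencyReadable G v u

module Reconstruction {n : ℕ} (G : Graph n) (oblique : VertexOblique G) (determined : AdjacencyDetermined G)
                      {m : ℕ} (H : Graph m) (same : SameVertexTypeSequence H G) where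

  private
    matching : Σ[ φ ∈ Fin m ⤖ Fin n ] (∀ x → vertexType H x ≡ vertexType G (Bijection.to φ x))
    matching = map-allFin-↭⇒⤖ (oblique _ _) same

    φ = proj₁ matching
    f = Bijection.to φ

    f-injective : Injective _≡_ _≡_ f
    f-injective = Bijection.injective φ

    type-f : ∀ x → vertexType H x ≡ vertexType G (f x)
    type-f = proj₂ matching

    degree-f : ∀ x → degree H x ≡ degree G (f x)
    degree-f x = vertexType≡⇒degree≡ H G (type-f x)

    preserves-via : ∀ {x y} → T (adj H x y) → AdjacencyReadable G (f x) (f y) → T (adj G (f x) (f y))
    preserves-via {x} {y} xy readable with ∈-vertexType⁻ G (subst (degree H y ∈_) (type-f x) (∈-vertexType⁺ H xy))
    ... | w , fx~w , dy≡dw = readable w fx~w (trans (sym dy≡dw) (degree-f y))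

    preserves : ∀ {x y} → T (adj H x y) → T (adj G (f x) (f y))
    preserves xy with determined _ _ (adjacent⇒≢ H xy ∘ f-injective)
    ... | inj₁ readable = preserves-via xy readable
    ... | inj₂ readable = adjacent-sym G (preserves-via (adjacent-sym H xy) readable)

    -- f maps the neighbours of x injectively into the equally many neighbours of f x.
    reflects : ∀ {x y} → T (adj G (f x) (f y)) → T (adj H x y)
    reflects {x} {y} fxy with T? (adj H x y)
    ... | yes xy = xy
    ... | no ¬xy = ⊥-elim (<-irrefl (trans (length-map f (neighbours H x)) (degree-f x))
          (Unique-⊆-∌⇒length< _≟ᶠ_ (unique-map⁺ f-injective (neighbours-unique H x)) image⊆
             (adjacent⇒∈neighbours G fxy) fy∉image))
      where
      image⊆ : map f (neighbours H x) ⊆ neighbours G (f x)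
      image⊆ z∈ with ∈-map⁻ f z∈
      ... | _ , w∈ , refl = adjacent⇒∈neighbours G (preserves (∈neighbours⇒adjacent H w∈))

      fy∉image : f y ∉ map f (neighbours H x)
      fy∉image fy∈ with ∈-map⁻ f fy∈
      ... | _ , w∈ , fy≡fw rewrite f-injective fy≡fw = ¬xy (∈neighbours⇒adjacent H w∈)

  isomorphic : Isomorphic H G
  isomorphic = φ , λ x y → T-⇔⇒≡ preserves reflects

unique-vertexType-sequence : {n : ℕ} (G : Graph n) → VertexOblique G → AdjacencyDetermined G →
                             UniqueVertexTypeSequence G
unique-vertexType-sequence G oblique determined _ H same = Reconstruction.isomorphic G oblique determined H same

↭-map-suc⁻ : ∀ {xs ys} → map suc xs ↭ map suc ys → xs ↭ ys
↭-map-suc⁻ {xs} {ys} = subst₂ _↭_ (pred∘suc xs) (pred∘suc ys) ∘ ↭-map⁺ pred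
  where
  pred∘suc : ∀ zs → map pred (map suc zs) ≡ zs
  pred∘suc zs = trans (sym (map-∘ zs)) (map-id zs)

pattern apex    = zero
pattern pendant = suc zero
pattern old x   = suc (suc x)

coneAdj : {n : ℕ} → (Fin n → Fin n → Bool) → Fin (2+ n) → Fin (2+ n) → Bool
coneAdj a apex    apex    = false
coneAdj a apex    (suc _) = true
coneAdj a (suc _) apex    = true
coneAdj a pendant (suc _) = false
coneAdj a (old _) pendant = false
coneAdj a (old x) (old y) = a x y

cone : {n : ℕ} → Graph n → Graph (2+ n)
cone G = record { adj = coneAdj (adj G) ; sym = coneAdj-sym ; irrefl = coneAdj-irrefl }
  where
  coneAdj-sym : ∀ u v → coneAdj (adj G) u v ≡ coneAdj (adj G) v u
  coneAdj-sym apex    apex    = refl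
  coneAdj-sym apex    (suc _) = refl
  coneAdj-sym (suc _) apex    = refl
  coneAdj-sym pendant pendant = refl
  coneAdj-sym pendant (old _) = refl
  coneAdj-sym (old _) pendant = refl
  coneAdj-sym (old x) (old y) = Graph.sym G x y

  coneAdj-irrefl : ∀ v → coneAdj (adj G) v v ≡ false
  coneAdj-irrefl apex    = refl
  coneAdj-irrefl pendant = refl
  coneAdj-irrefl (old x) = irrefl G x

module Cone {n : ℕ} (G : Graph n) where

  private
    filter-old : ∀ u → filter (T? ∘ adj (cone G) u) (tabulate old) ≡
                       map old (filter (T? ∘ adj (cone G) u ∘ old) (allFin n))
    filter-old u = trans (cong (filter _) (sym (map-tabulate id old))) (filter-map _ old (allFin n))

  neighbours-apex : neighbours (cone G) apex ≡ pendant ∷ map old (allFin n)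
  neighbours-apex = begin
    neighbours (cone G) apex                                      ≡⟨ neighbours≡filter (cone G) apex ⟩
    pendant ∷ filter (T? ∘ adj (cone G) apex) (tabulate old)      ≡⟨ cong (pendant ∷_) (filter-old apex) ⟩
    pendant ∷ map old (filter (λ _ → T? true) (allFin n))         ≡⟨ cong (λ vs → pendant ∷ map old vs)
                                                                      (filter-all _ (All.universal _ (allFin n))) ⟩
    pendant ∷ map old (allFin n)                                  ∎
    where open ≡-Reasoning

  neighbours-pendant : neighbours (cone G) pendant ≡ apex ∷ []
  neighbours-pendant = begin
    neighbours (cone G) pendant                                   ≡⟨ neighbours≡filter (cone G) pendant ⟩
    apex ∷ filter (T? ∘ adj (cone G) pendant) (tabulate old)      ≡⟨ cong (apex ∷_) (filter-old pendant) ⟩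
    apex ∷ map old (filter (λ _ → T? false) (allFin n))           ≡⟨ cong (λ vs → apex ∷ map old vs)
                                                                      (filter-none _ (All.universal (λ _ → id) (allFin n))) ⟩
    apex ∷ []                                                     ∎
    where open ≡-Reasoning

  neighbours-old : ∀ x → neighbours (cone G) (old x) ≡ apex ∷ map old (neighbours G x)
  neighbours-old x = begin
    neighbours (cone G) (old x)                                   ≡⟨ neighbours≡filter (cone G) (old x) ⟩
    apex ∷ filter (T? ∘ adj (cone G) (old x)) (tabulate old)      ≡⟨ cong (apex ∷_) (filter-old (old x)) ⟩
    apex ∷ map old (filter (T? ∘ adj G x) (allFin n))             ≡⟨ cong (λ vs → apex ∷ map old vs)
                                                                      (sym (neighbours≡filter G x)) ⟩
    apex ∷ map old (neighbours G x)                               ∎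
    where open ≡-Reasoning

  degree-apex : degree (cone G) apex ≡ suc n
  degree-apex = trans (cong length neighbours-apex) (cong suc (trans (length-map old (allFin n)) (length-tabulate id)))

  degree-pendant : degree (cone G) pendant ≡ 1
  degree-pendant = cong length neighbours-pendant

  degree-old : ∀ x → degree (cone G) (old x) ≡ suc (degree G x)
  degree-old x = trans (cong length (neighbours-old x)) (cong suc (length-map old (neighbours G x)))

  neighbourDegrees-old : ∀ x → neighbourDegrees (cone G) (old x) ≡ suc n ∷ map suc (neighbourDegrees G x)
  neighbourDegrees-old x = begin
    map (degree (cone G)) (neighbours (cone G) (old x))           ≡⟨ cong (map (degree (cone G))) (neighbours-old x) ⟩
    degree (cone G) apex ∷ map (degree (cone G)) (map old vs)     ≡⟨ cong₂ _∷_ degree-apex (sym (map-∘ vs)) ⟩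
    suc n ∷ map (degree (cone G) ∘ old) vs                        ≡⟨ cong (suc n ∷_) (map-cong degree-old vs) ⟩
    suc n ∷ map (suc ∘ degree G) vs                               ≡⟨ cong (suc n ∷_) (map-∘ vs) ⟩
    suc n ∷ map suc (map (degree G) vs)                           ∎
    where
    open ≡-Reasoning
    vs = neighbours G x

  cone-connected : Connected (cone G)
  cone-connected = (apex , tt) , walk
    where
    from-apex : ∀ v → Walk (cone G) apex v
    from-apex apex    = here
    from-apex (suc v) = step {w = suc v} tt here

    walk : ∀ u v → Walk (cone G) u v
    walk apex    v = from-apex v
    walk (suc u) v = step {w = apex} tt (from-apex v)

  degree-cone≢0 : ∀ v → degree (cone G) v ≢ 0
  degree-cone≢0 apex    eq = case trans (sym degree-apex) eq of λ ()
  degree-cone≢0 pendant eq = case trans (sym degree-pendant) eq of λ ()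
  degree-cone≢0 (old x) eq = case trans (sym (degree-old x)) eq of λ ()

  vertexType-old-cancel : ∀ {x y} → vertexType (cone G) (old x) ≡ vertexType (cone G) (old y) →
                          vertexType G x ≡ vertexType G y
  vertexType-old-cancel {x} {y} eq = ↭⇒sortDesc-≡ (↭-map-suc⁻ (drop-∷
    (subst₂ _↭_ (neighbourDegrees-old x) (neighbourDegrees-old y) (sortDesc-≡⇒↭ eq))))

  -- In the complement every vertex has a non-neighbour besides itself: the apex, or for the apex the pendant.
  degree-complement< : ∀ v → degree (complement (cone G)) v < suc n
  degree-complement< apex    = ≤-pred (non-neighbour⇒degree< (complement (cone G)) {apex} {pendant} (λ ()) id)
  degree-complement< (suc v) = ≤-pred (non-neighbour⇒degree< (complement (cone G)) {suc v} {apex} (λ ()) id)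

  vertexType-cone≢complement : ∀ u v → vertexType (cone G) u ≢ vertexType (complement (cone G)) v
  vertexType-cone≢complement apex v eq = <-irrefl
    (trans (sym (vertexType≡⇒degree≡ (cone G) (complement (cone G)) {apex} {v} eq)) degree-apex)
    (degree-complement< v)
  vertexType-cone≢complement (suc u) v eq with ∈-vertexType⁻ (complement (cone G)) {v}
    (subst (degree (cone G) apex ∈_) eq (∈-vertexType⁺ (cone G) {suc u} {apex} tt))
  ... | w , _ , d≡ = <-irrefl (trans (sym d≡) degree-apex) (degree-complement< w)

record Admissible {n : ℕ} (G : Graph n) : Set where
  field
    oblique     : VertexOblique G
    determined  : AdjacencyDetermined G
    no-isolated : ∀ v → degree G v ≢ 0

module ConeAdmissible {k : ℕ} {G : Graph (suc k)} (admissible : Admissible G) where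

  open Admissible admissible
  open Cone G

  private
    same-degree : ∀ u v → vertexType (cone G) u ≡ vertexType (cone G) v → degree (cone G) u ≡ degree (cone G) v
    same-degree u v = vertexType≡⇒degree≡ (cone G) (cone G) {u} {v}

    apex-by-degree : ∀ {w} → degree (cone G) w ≡ degree (cone G) apex → w ≡ apex
    apex-by-degree {apex}    _  = refl
    apex-by-degree {pendant} eq = case trans (sym degree-pendant) (trans eq degree-apex) of λ ()
    apex-by-degree {old y}   eq =
      ⊥-elim (<-irrefl (suc-injective (trans (sym (degree-old y)) (trans eq degree-apex))) (degree<order G y))

    pendant-by-degree : ∀ {w} → degree (cone G) w ≡ degree (cone G) pendant → w ≡ pendant
    pendant-by-degree {apex}    eq = case trans (sym degree-apex) (trans eq degree-pendant) of λ ()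
    pendant-by-degree {pendant} _  = refl
    pendant-by-degree {old y}   eq =
      ⊥-elim (no-isolated y (suc-injective (trans (sym (degree-old y)) (trans eq degree-pendant))))

    readable-apex : ∀ u → AdjacencyReadable (cone G) u apex
    readable-apex u w uw eq = subst (T ∘ adj (cone G) u) (apex-by-degree eq) uw

    readable-pendant : ∀ u → AdjacencyReadable (cone G) u pendant
    readable-pendant u w uw eq = subst (T ∘ adj (cone G) u) (pendant-by-degree eq) uw

    readable-old : ∀ {x y} → AdjacencyReadable G x y → AdjacencyReadable (cone G) (old x) (old y)
    readable-old {y = y} _ apex _ eq = case apex-by-degree {old y} (sym eq) of λ ()
    readable-old {y = y} readable (old z) xz eq =
      readable z xz (suc-injective (trans (sym (degree-old z)) (trans eq (degree-old y))))

  cone-determined : AdjacencyDetermined (cone G)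
  cone-determined u       apex    _ = inj₁ (readable-apex u)
  cone-determined u       pendant _ = inj₁ (readable-pendant u)
  cone-determined apex    (old y) _ = inj₂ (readable-apex (old y))
  cone-determined pendant (old y) _ = inj₂ (readable-pendant (old y))
  cone-determined (old x) (old y) x≢y with determined x y (x≢y ∘ cong old)
  ... | inj₁ readable = inj₁ (readable-old readable)
  ... | inj₂ readable = inj₂ (readable-old readable)

  cone-oblique : VertexOblique (cone G)
  cone-oblique apex    v       eq = sym (apex-by-degree (sym (same-degree apex v eq)))
  cone-oblique pendant v       eq = sym (pendant-by-degree (sym (same-degree pendant v eq)))
  cone-oblique (old x) apex    eq = apex-by-degree (same-degree (old x) apex eq)
  cone-oblique (old x) pendant eq = pendant-by-degree (same-degree (old x) pendant eq)
  cone-oblique (old x) (old y) eq = cong old (oblique x y (vertexType-old-cancel {x} {y} eq))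

  cone-admissible : Admissible (cone G)
  cone-admissible = record
    { oblique = cone-oblique ; determined = cone-determined ; no-isolated = degree-cone≢0 }

  cone-superVertexOblique : SuperVertexOblique (cone G)
  cone-superVertexOblique = cone-oblique , vertexType-cone≢complement

baseEdge : ℕ → ℕ → Bool
baseEdge 0 1 = true
baseEdge 0 2 = true
baseEdge 0 3 = true
baseEdge 0 5 = true
baseEdge 1 2 = true
baseEdge 1 4 = true
baseEdge 2 3 = true
baseEdge _ _ = false

base : Graph 6
base = record
  { adj    = baseAdj
  ; sym    = λ u v → ∨-comm (baseEdge (toℕ u) (toℕ v)) (baseEdge (toℕ v) (toℕ u))
  ; irrefl = toWitness {a? = all? λ v → baseAdj v v ≟ᵇ false} tt
  }
  where
  baseAdj : Fin 6 → Fin 6 → Bool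
  baseAdj u v = baseEdge (toℕ u) (toℕ v) ∨ baseEdge (toℕ v) (toℕ u)

base-admissible : Admissible base
base-admissible = record
  { oblique     = toWitness {a? = all? λ u → all? λ v →
                    ≡-dec ℕ._≟_ (vertexType base u) (vertexType base v) →-dec (u ≟ᶠ v)} tt
  ; determined  = toWitness {a? = all? λ u → all? λ v → ¬? (u ≟ᶠ v) →-dec (readable? u v ⊎-dec readable? v u)} tt
  ; no-isolated = toWitness {a? = all? λ v → ¬? (degree base v ℕ.≟ 0)} tt
  }
  where
  readable? : ∀ u v → Dec (AdjacencyReadable base u v)
  readable? u v = all? λ w → T? (adj base u w) →-dec (degree base w ℕ.≟ degree base v) →-dec T? (adj base u v)

order : ℕ → ℕ
order zero    = 5
order (suc i) = 2+ (order i)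

order-injective : ∀ {i j} → order i ≡ order j → i ≡ j
order-injective {i} {j} eq =
  suc-injective (suc-injective (trans (sym (⌊order/2⌋ i)) (trans (cong ⌊_/2⌋ eq) (⌊order/2⌋ j))))
  where
  ⌊order/2⌋ : ∀ i → ⌊ order i /2⌋ ≡ 2+ i
  ⌊order/2⌋ zero    = refl
  ⌊order/2⌋ (suc i) = cong suc (⌊order/2⌋ i)

tower : (i : ℕ) → Graph (suc (order i))
tower zero    = base
tower (suc i) = cone (tower i)

tower-admissible : ∀ i → Admissible (tower i)
tower-admissible zero    = base-admissible
tower-admissible (suc i) = ConeAdmissible.cone-admissible (tower-admissible i)

corollary6 : Σ (ℕ → Σ ℕ Graph) λ 𝒢 →
    (∀ k → Connected (proj₂ (𝒢 k))
           × SuperVertexOblique (proj₂ (𝒢 k))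
           × UniqueVertexTypeSequence (proj₂ (𝒢 k)))
    × (∀ i j → i ≢ j → ¬ Isomorphic (proj₂ (𝒢 i)) (proj₂ (𝒢 j)))
corollary6 = (λ k → _ , tower (suc k)) , properties , non-isomorphic
  where
  properties : ∀ k → Connected (tower (suc k)) × SuperVertexOblique (tower (suc k))
                   × UniqueVertexTypeSequence (tower (suc k))
  properties k = Cone.cone-connected (tower k)
               , ConeAdmissible.cone-superVertexOblique (tower-admissible k)
               , unique-vertexType-sequence (tower (suc k)) oblique determined
    where open Admissible (tower-admissible (suc k))

  non-isomorphic : ∀ i j → i ≢ j → ¬ Isomorphic (tower (suc i)) (tower (suc j))
  non-isomorphic i j i≢j iso =
    i≢j (suc-injective (order-injective (suc-injective (Isomorphic⇒order≡ (tower (suc i)) (tower (suc j)) iso))))
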